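{- (a) $T(1)=T(F)=T(F^2)=0$ and $T(F^3)=F$. (b) $T$ maps $\mathbb{Z}/2[F]$ into itself; in fact, for every $n\ge 0$, $T(F^n)$ is a sum of $F^k$ with $k\le n-2$ and $k\equiv n\pmod 2$.
   Context: $\mathbb{Z}/2[r]$ is the polynomial ring over the field with two elements. Let $F=r(r+1)^3$ and $G=r^3(r+1)$. $\mathbb{Z}/2[r]$ is a free $\mathbb{Z}/2[G]$-module with basis $1,r,r^2,r^3$. Let $U:\mathbb{Z}/2[r]\to\mathbb{Z}/2[r]$ be the map $U\big(\sum_{i=0}^3 g_i(G)r^i\big)=\sum_{i=0}^3 g_i(F)\,U(r^i)$ (for polynomials $g_i$ over $\mathbb{Z}/2$), where $U(1)=1$, $U(r)=r$, $U(r^2)=r^2$, $U(r^3)=r^3+r^2+r$. Let $\alpha:\mathbb{Z}/2[F]\to\mathbb{Z}/2[G]$ be the ring isomorphism with $\alpha(F^n)=G^n$. For $f\in\mathbb{Z}/2[F]$, $T(f)=U(f)+\alpha(f)$. -}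

module Defs where

open import Data.Bool using (Bool; true; false; _xor_; if_then_else_)
open import Data.List using (List; []; _∷_; foldr)
open import Data.Nat using (ℕ; zero; suc)
open import Data.Fin using (Fin)
open import Data.Vec using (Vec; []; _∷_; zipWith; replicate; lookup; head)
open import Relation.Binary.PropositionalEquality using (_≡_)

-- Polynomials over ℤ/2 in one variable, as coefficient lists
-- (lowest degree first).  Lists differing only by trailing zero
-- coefficients denote the same polynomial; equality of polynomials is
-- _≈ₚ_ below (equality of normal forms).

Poly : Set
Poly = List Bool

infixl 6 _⊕_
infixl 7 _⊗_
infixr 8 _^ₚ_

_⊕_ : Poly → Poly → Poly
[] ⊕ q = q
(a ∷ p) ⊕ [] = a ∷ p
(a ∷ p) ⊕ (b ∷ q) = (a xor b) ∷ (p ⊕ q)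

scale : Bool → Poly → Poly
scale false _ = []
scale true p = p

_⊗_ : Poly → Poly → Poly
[] ⊗ q = []
(a ∷ p) ⊗ q = scale a q ⊕ (false ∷ (p ⊗ q))

zeroₚ oneₚ X : Poly
zeroₚ = []
oneₚ = true ∷ []
X = false ∷ true ∷ []

_^ₚ_ : Poly → ℕ → Poly
p ^ₚ zero = oneₚ
p ^ₚ suc n = p ⊗ (p ^ₚ n)

_∘ₚ_ : Poly → Poly → Poly
g ∘ₚ h = foldr (λ c acc → (c ∷ []) ⊕ (h ⊗ acc)) [] g

consN : Bool → Poly → Poly
consN false [] = []
consN true [] = true ∷ []
consN a (b ∷ q) = a ∷ b ∷ q

norm : Poly → Poly
norm [] = []
norm (a ∷ p) = consN a (norm p)

infix 4 _≈ₚ_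
_≈ₚ_ : Poly → Poly → Set
p ≈ₚ q = norm p ≡ norm q

coeff : Poly → ℕ → Bool
coeff [] _ = false
coeff (a ∷ p) zero = a
coeff (a ∷ p) (suc k) = coeff p k

r : Poly
r = X

F G : Poly
F = r ⊗ (r ⊕ oneₚ) ^ₚ 3
G = r ^ₚ 3 ⊗ (r ⊕ oneₚ)

-- Coordinates of an element of ℤ/2[r] in the basis 1,r,r²,r³ of
-- ℤ/2[r] as a free ℤ/2[G]-module: p = Σᵢ gᵢ(G) rⁱ, where the vector
-- holds g₀,…,g₃ as polynomials (in a variable standing for G).

Coords : Set
Coords = Vec Poly 4

_⊕v_ : Coords → Coords → Coords
_⊕v_ = zipWith _⊕_

zeroV : Coords
zeroV = replicate 4 []

shiftG : Coords → Coords
shiftG = Data.Vec.map (false ∷_)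

-- window m = (coords of r^m, r^(m+1), r^(m+2), r^(m+3)),
-- using r^(m+4) = G·r^m + r^(m+3)   (since G = r⁴ + r³).
window : ℕ → Vec Coords 4
window zero =
  (oneₚ ∷ [] ∷ [] ∷ [] ∷ []) ∷
  ([] ∷ oneₚ ∷ [] ∷ [] ∷ []) ∷
  ([] ∷ [] ∷ oneₚ ∷ [] ∷ []) ∷
  ([] ∷ [] ∷ [] ∷ oneₚ ∷ []) ∷ []
window (suc m) with window m
... | a ∷ b ∷ c ∷ d ∷ [] = b ∷ c ∷ d ∷ (shiftG a ⊕v d) ∷ []

monoCoords : ℕ → Coords
monoCoords m = head (window m)

coordsFrom : ℕ → Poly → Coords
coordsFrom m [] = zeroV
coordsFrom m (a ∷ p) =
  (if a then monoCoords m else zeroV) ⊕v coordsFrom (suc m) p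

coords : Poly → Coords
coords = coordsFrom 0

Ubasis : Vec Poly 4
Ubasis = oneₚ ∷ r ∷ r ^ₚ 2 ∷ (r ^ₚ 3 ⊕ r ^ₚ 2 ⊕ r) ∷ []

-- U(Σ gᵢ(G) rⁱ) = Σ gᵢ(F) U(rⁱ)
U : Poly → Poly
U p = Data.Vec.foldr (λ _ → Poly) _⊕_ []
        (zipWith (λ g u → (g ∘ₚ F) ⊗ u) (coords p) Ubasis)

-- An element f of ℤ/2[F] is represented by a polynomial h with f = h(F).
-- α(h(F)) = h(G), and T(f) = U(f) + α(f).
T : Poly → Poly
T h = U (h ∘ₚ F) ⊕ (h ∘ₚ G)

-- Since F + G = r(r + 1), the polynomials satisfy F⁴ + G⁴ = FG. The map U is additive and
-- U(G p) = F U(p), because multiplying by G shifts the coordinates over ℤ/2[G]. Applying U to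
-- F^(n+4) = G⁴Fⁿ + G F^(n+1) and adding G^(n+4) = F⁴Gⁿ + F G^(n+1) yields the recurrence
-- T(F^(n+4)) = F⁴ T(Fⁿ) + F T(F^(n+1)). From the initial values T(1) = T(F) = T(F²) = 0 and
-- T(F³) = F, computed directly, induction shows that T(Fⁿ) is a polynomial in F all of whose
-- exponents k satisfy k ≤ n − 2 and k ≡ n (mod 2); by additivity, T maps ℤ/2[F] into itself.
module Submission where

open import Defs
open import Algebra.Bundles using (CommutativeMonoid)
open import Algebra.Structures using (IsCommutativeMonoid)
import Algebra.Properties.CommutativeSemigroup as CommutativeSemigroupProperties
open import Data.Bool using (Bool; true; false; _xor_; if_then_else_)
open import Data.Bool.Properties using (xor-assoc; xor-comm; xor-identityʳ; xor-same)
open import Data.List using ([]; _∷_)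
open import Data.Nat using (ℕ; zero; suc; _+_; _≤_; _%_; z≤n; s≤s)
open import Data.Nat.Properties using (+-comm; +-suc; +-monoʳ-≤; m≤n⇒m≤1+n)
open import Data.Nat.DivMod using ([m+n]%n≡m%n; %-distribˡ-+)
open import Data.Product using (Σ; ∃; _×_; _,_)
open import Data.Sum using (_⊎_; inj₁; inj₂)
open import Data.Vec as Vec using (Vec; []; _∷_; zipWith; replicate)
open import Data.Vec.Relation.Binary.Pointwise.Inductive as Pointwise
  using (Pointwise; []; _∷_)
open import Relation.Binary.Bundles using (Setoid)
open import Relation.Binary.Structures using (IsEquivalence)
open import Relation.Binary.PropositionalEquality
  using (_≡_; refl; sym; trans; cong; cong₂; module ≡-Reasoning)
import Relation.Binary.Reasoning.Setoid as SetoidReasoning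

-- Polynomial equality: _≈ₚ_ as a record, so that p and q can be inferred from a proof.
infix 4 _≈_
record _≈_ (p q : Poly) : Set where
  constructor mk≈
  field norm≡ : norm p ≡ norm q
open _≈_ public

≈-refl : ∀ {p} → p ≈ p
≈-refl = mk≈ refl

≈-sym : ∀ {p q} → p ≈ q → q ≈ p
≈-sym (mk≈ e) = mk≈ (sym e)

≈-trans : ∀ {p q s} → p ≈ q → q ≈ s → p ≈ s
≈-trans (mk≈ e) (mk≈ f) = mk≈ (trans e f)

≈-isEquivalence : IsEquivalence _≈_
≈-isEquivalence = record { refl = ≈-refl ; sym = ≈-sym ; trans = ≈-trans }

≈-setoid : Setoid _ _
≈-setoid = record { isEquivalence = ≈-isEquivalence }

module ≈-Reasoning = SetoidReasoning ≈-setoid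

∷-cong : ∀ a {p q} → p ≈ q → a ∷ p ≈ a ∷ q
∷-cong a (mk≈ e) = mk≈ (cong (consN a) e)

coeff-consN : ∀ a p k → coeff (consN a p) k ≡ coeff (a ∷ p) k
coeff-consN false []      zero    = refl
coeff-consN false []      (suc k) = refl
coeff-consN true  []      k       = refl
coeff-consN false (b ∷ p) k       = refl
coeff-consN true  (b ∷ p) k       = refl

coeff-norm : ∀ p k → coeff (norm p) k ≡ coeff p k
coeff-norm []      k       = refl
coeff-norm (a ∷ p) k       with coeff-consN a (norm p) k
coeff-norm (a ∷ p) zero    | e = e
coeff-norm (a ∷ p) (suc k) | e = trans e (coeff-norm p k)

≈⇒coeff≡ : ∀ {p q} → p ≈ q → ∀ k → coeff p k ≡ coeff q k
≈⇒coeff≡ {p} {q} (mk≈ e) k = begin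
  coeff p k        ≡⟨ coeff-norm p k ⟨
  coeff (norm p) k ≡⟨ cong (λ s → coeff s k) e ⟩
  coeff (norm q) k ≡⟨ coeff-norm q k ⟩
  coeff q k        ∎
  where open ≡-Reasoning

coeff≡⇒≈ : ∀ p q → (∀ k → coeff p k ≡ coeff q k) → p ≈ q
coeff≡⇒≈ []      []      _ = ≈-refl
coeff≡⇒≈ []      (b ∷ q) h with refl ← h zero =
  ≈-trans (mk≈ refl) (∷-cong false (coeff≡⇒≈ [] q (λ k → h (suc k))))
coeff≡⇒≈ (a ∷ p) []      h with refl ← h zero =
  ≈-trans (∷-cong false (coeff≡⇒≈ p [] (λ k → h (suc k)))) (mk≈ refl)
coeff≡⇒≈ (a ∷ p) (b ∷ q) h with refl ← h zero = ∷-cong a (coeff≡⇒≈ p q (λ k → h (suc k)))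

coeff-⊕ : ∀ p q k → coeff (p ⊕ q) k ≡ coeff p k xor coeff q k
coeff-⊕ []      q       k       = refl
coeff-⊕ (a ∷ p) []      k       = sym (xor-identityʳ _)
coeff-⊕ (a ∷ p) (b ∷ q) zero    = refl
coeff-⊕ (a ∷ p) (b ∷ q) (suc k) = coeff-⊕ p q k

⊕-cong : ∀ {p p′ q q′} → p ≈ p′ → q ≈ q′ → p ⊕ q ≈ p′ ⊕ q′
⊕-cong {p} {p′} {q} {q′} e f = coeff≡⇒≈ _ _ λ k → begin
  coeff (p ⊕ q) k            ≡⟨ coeff-⊕ p q k ⟩
  coeff p k xor coeff q k    ≡⟨ cong₂ _xor_ (≈⇒coeff≡ e k) (≈⇒coeff≡ f k) ⟩
  coeff p′ k xor coeff q′ k  ≡⟨ coeff-⊕ p′ q′ k ⟨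
  coeff (p′ ⊕ q′) k          ∎
  where open ≡-Reasoning

⊕-assoc : ∀ p q s → (p ⊕ q) ⊕ s ≈ p ⊕ (q ⊕ s)
⊕-assoc p q s = coeff≡⇒≈ _ _ coeffwise
  where
  coeffwise : ∀ k → coeff ((p ⊕ q) ⊕ s) k ≡ coeff (p ⊕ (q ⊕ s)) k
  coeffwise k rewrite coeff-⊕ (p ⊕ q) s k | coeff-⊕ p q k
                    | coeff-⊕ p (q ⊕ s) k | coeff-⊕ q s k
    = xor-assoc (coeff p k) (coeff q k) (coeff s k)

⊕-comm : ∀ p q → p ⊕ q ≈ q ⊕ p
⊕-comm p q = coeff≡⇒≈ _ _ coeffwise
  where
  coeffwise : ∀ k → coeff (p ⊕ q) k ≡ coeff (q ⊕ p) k
  coeffwise k rewrite coeff-⊕ p q k | coeff-⊕ q p k = xor-comm (coeff p k) (coeff q k)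

⊕-identityʳ : ∀ p → p ⊕ [] ≈ p
⊕-identityʳ []      = ≈-refl
⊕-identityʳ (a ∷ p) = ≈-refl

⊕-self : ∀ p → p ⊕ p ≈ []
⊕-self p = coeff≡⇒≈ _ _ λ k → trans (coeff-⊕ p p k) (xor-same (coeff p k))

⊕-isCommutativeMonoid : IsCommutativeMonoid _≈_ _⊕_ []
⊕-isCommutativeMonoid = record
  { isMonoid = record
    { isSemigroup = record
      { isMagma = record { isEquivalence = ≈-isEquivalence ; ∙-cong = ⊕-cong }
      ; assoc   = ⊕-assoc
      }
    ; identity = (λ _ → ≈-refl) , ⊕-identityʳ
    }
  ; comm = ⊕-comm
  }

⊕-commutativeMonoid : CommutativeMonoid _ _
⊕-commutativeMonoid = record { isCommutativeMonoid = ⊕-isCommutativeMonoid }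

open CommutativeSemigroupProperties (CommutativeMonoid.commutativeSemigroup ⊕-commutativeMonoid)
  using () renaming (interchange to ⊕-interchange)

⊕-cancelˡ : ∀ p q → p ⊕ (q ⊕ p) ≈ q
⊕-cancelˡ p q = begin
  p ⊕ (q ⊕ p) ≈⟨ ⊕-cong (≈-refl {p}) (⊕-comm q p) ⟩
  p ⊕ (p ⊕ q) ≈⟨ ⊕-assoc p p q ⟨
  (p ⊕ p) ⊕ q ≈⟨ ⊕-cong (⊕-self p) ≈-refl ⟩
  q           ∎
  where open ≈-Reasoning

scale-cong : ∀ a {q q′} → q ≈ q′ → scale a q ≈ scale a q′
scale-cong false e = ≈-refl
scale-cong true  e = e

scale-⊕ : ∀ a p q → scale a (p ⊕ q) ≡ scale a p ⊕ scale a q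
scale-⊕ false p q = refl
scale-⊕ true  p q = refl

scale-xor : ∀ a b q → scale (a xor b) q ≈ scale a q ⊕ scale b q
scale-xor false b     q = ≈-refl
scale-xor true  false q = ≈-sym (⊕-identityʳ q)
scale-xor true  true  q = ≈-sym (⊕-self q)

scale-⊗ : ∀ a q s → scale a q ⊗ s ≡ scale a (q ⊗ s)
scale-⊗ false q s = refl
scale-⊗ true  q s = refl

⊗-zeroʳ : ∀ p → p ⊗ [] ≈ []
⊗-zeroʳ []      = ≈-refl
⊗-zeroʳ (false ∷ p) = ≈-trans (∷-cong false (⊗-zeroʳ p)) (mk≈ refl)
⊗-zeroʳ (true  ∷ p) = ≈-trans (∷-cong false (⊗-zeroʳ p)) (mk≈ refl)

⊗-identityˡ : ∀ p → oneₚ ⊗ p ≈ p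
⊗-identityˡ p = ≈-trans (⊕-comm p (false ∷ [])) (zero-∷-⊕ p)
  where
  zero-∷-⊕ : ∀ p → (false ∷ []) ⊕ p ≈ p
  zero-∷-⊕ []      = mk≈ refl
  zero-∷-⊕ (b ∷ p) = ≈-refl

X⊗ : ∀ q → X ⊗ q ≈ false ∷ q
X⊗ q = ∷-cong false (⊗-identityˡ q)

⊗-congˡ : ∀ p {q q′} → q ≈ q′ → p ⊗ q ≈ p ⊗ q′
⊗-congˡ []      e = ≈-refl
⊗-congˡ (a ∷ p) e = ⊕-cong (scale-cong a e) (∷-cong false (⊗-congˡ p e))

⊗-norm : ∀ p q → p ⊗ q ≈ norm p ⊗ q
⊗-norm []      q = ≈-refl
⊗-norm (a ∷ p) q = ≈-trans (⊕-cong ≈-refl (∷-cong false (⊗-norm p q))) (consN-⊗ a (norm p))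
  where
  consN-⊗ : ∀ a x → (a ∷ x) ⊗ q ≈ consN a x ⊗ q
  consN-⊗ false []      = mk≈ refl
  consN-⊗ true  []      = ≈-refl
  consN-⊗ false (b ∷ x) = ≈-refl
  consN-⊗ true  (b ∷ x) = ≈-refl

⊗-congʳ : ∀ {p p′} q → p ≈ p′ → p ⊗ q ≈ p′ ⊗ q
⊗-congʳ {p} {p′} q (mk≈ e) = begin
  p ⊗ q      ≈⟨ ⊗-norm p q ⟩
  norm p ⊗ q ≡⟨ cong (_⊗ q) e ⟩
  norm p′ ⊗ q ≈⟨ ⊗-norm p′ q ⟨
  p′ ⊗ q     ∎
  where open ≈-Reasoning

⊗-distribˡ-⊕ : ∀ p q s → p ⊗ (q ⊕ s) ≈ p ⊗ q ⊕ p ⊗ s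
⊗-distribˡ-⊕ []      q s = ≈-refl
⊗-distribˡ-⊕ (a ∷ p) q s = begin
  scale a (q ⊕ s) ⊕ (false ∷ p ⊗ (q ⊕ s))
    ≈⟨ ⊕-cong (mk≈ (cong norm (scale-⊕ a q s))) (∷-cong false (⊗-distribˡ-⊕ p q s)) ⟩
  (scale a q ⊕ scale a s) ⊕ ((false ∷ p ⊗ q) ⊕ (false ∷ p ⊗ s))
    ≈⟨ ⊕-interchange (scale a q) (scale a s) (false ∷ p ⊗ q) (false ∷ p ⊗ s) ⟩
  (scale a q ⊕ (false ∷ p ⊗ q)) ⊕ (scale a s ⊕ (false ∷ p ⊗ s)) ∎
  where open ≈-Reasoning

⊗-distribʳ-⊕ : ∀ p q s → (p ⊕ q) ⊗ s ≈ p ⊗ s ⊕ q ⊗ s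
⊗-distribʳ-⊕ []      q       s = ≈-refl
⊗-distribʳ-⊕ (a ∷ p) []      s = ≈-sym (⊕-identityʳ _)
⊗-distribʳ-⊕ (a ∷ p) (b ∷ q) s = begin
  scale (a xor b) s ⊕ (false ∷ (p ⊕ q) ⊗ s)
    ≈⟨ ⊕-cong (scale-xor a b s) (∷-cong false (⊗-distribʳ-⊕ p q s)) ⟩
  (scale a s ⊕ scale b s) ⊕ ((false ∷ p ⊗ s) ⊕ (false ∷ q ⊗ s))
    ≈⟨ ⊕-interchange (scale a s) (scale b s) (false ∷ p ⊗ s) (false ∷ q ⊗ s) ⟩
  (scale a s ⊕ (false ∷ p ⊗ s)) ⊕ (scale b s ⊕ (false ∷ q ⊗ s)) ∎
  where open ≈-Reasoning

⊗-assoc : ∀ p q s → (p ⊗ q) ⊗ s ≈ p ⊗ (q ⊗ s)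
⊗-assoc []      q s = ≈-refl
⊗-assoc (a ∷ p) q s = begin
  (scale a q ⊕ (false ∷ p ⊗ q)) ⊗ s       ≈⟨ ⊗-distribʳ-⊕ (scale a q) (false ∷ p ⊗ q) s ⟩
  scale a q ⊗ s ⊕ (false ∷ (p ⊗ q) ⊗ s)   ≈⟨ ⊕-cong (mk≈ (cong norm (scale-⊗ a q s))) (∷-cong false (⊗-assoc p q s)) ⟩
  scale a (q ⊗ s) ⊕ (false ∷ p ⊗ (q ⊗ s)) ∎
  where open ≈-Reasoning


∘-norm : ∀ g P → g ∘ₚ P ≈ norm g ∘ₚ P
∘-norm []      P = ≈-refl
∘-norm (a ∷ g) P =
  ≈-trans (⊕-cong (≈-refl {a ∷ []}) (⊗-congˡ P (∘-norm g P))) (consN-∘ a (norm g))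
  where
  consN-∘ : ∀ a x → (a ∷ x) ∘ₚ P ≈ consN a x ∘ₚ P
  consN-∘ false []      = ≈-trans (⊕-cong (≈-refl {false ∷ []}) (⊗-zeroʳ P)) (mk≈ refl)
  consN-∘ true  []      = ≈-refl
  consN-∘ false (b ∷ x) = ≈-refl
  consN-∘ true  (b ∷ x) = ≈-refl

∘-congʳ : ∀ {g g′} P → g ≈ g′ → g ∘ₚ P ≈ g′ ∘ₚ P
∘-congʳ {g} {g′} P (mk≈ e) = begin
  g ∘ₚ P       ≈⟨ ∘-norm g P ⟩
  norm g ∘ₚ P  ≡⟨ cong (_∘ₚ P) e ⟩
  norm g′ ∘ₚ P ≈⟨ ∘-norm g′ P ⟨
  g′ ∘ₚ P      ∎
  where open ≈-Reasoning

∘-distribʳ-⊕ : ∀ g g′ P → (g ⊕ g′) ∘ₚ P ≈ g ∘ₚ P ⊕ g′ ∘ₚ P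
∘-distribʳ-⊕ []      g′       P = ≈-refl
∘-distribʳ-⊕ (a ∷ g) []       P = ≈-sym (⊕-identityʳ _)
∘-distribʳ-⊕ (a ∷ g) (b ∷ g′) P = begin
  ((a xor b) ∷ []) ⊕ P ⊗ ((g ⊕ g′) ∘ₚ P)
    ≈⟨ ⊕-cong ≈-refl (≈-trans (⊗-congˡ P (∘-distribʳ-⊕ g g′ P)) (⊗-distribˡ-⊕ P _ _)) ⟩
  ((a ∷ []) ⊕ (b ∷ [])) ⊕ (P ⊗ (g ∘ₚ P) ⊕ P ⊗ (g′ ∘ₚ P))
    ≈⟨ ⊕-interchange (a ∷ []) (b ∷ []) (P ⊗ (g ∘ₚ P)) (P ⊗ (g′ ∘ₚ P)) ⟩
  ((a ∷ []) ⊕ P ⊗ (g ∘ₚ P)) ⊕ ((b ∷ []) ⊕ P ⊗ (g′ ∘ₚ P)) ∎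
  where open ≈-Reasoning

false∷-∘ : ∀ g P → (false ∷ g) ∘ₚ P ≈ P ⊗ (g ∘ₚ P)
false∷-∘ g P with P ⊗ (g ∘ₚ P)
... | []    = mk≈ refl
... | _ ∷ _ = ≈-refl

^-+ : ∀ P m n → P ^ₚ (m + n) ≈ P ^ₚ m ⊗ P ^ₚ n
^-+ P zero    n = ≈-sym (⊗-identityˡ (P ^ₚ n))
^-+ P (suc m) n = ≈-trans (⊗-congˡ P (^-+ P m n)) (≈-sym (⊗-assoc P (P ^ₚ m) (P ^ₚ n)))

X^-∘ : ∀ n P → (X ^ₚ n) ∘ₚ P ≈ P ^ₚ n
X^-∘ zero    P = ⊕-cong (≈-refl {oneₚ}) (⊗-zeroʳ P)
X^-∘ (suc n) P = begin
  (X ⊗ X ^ₚ n) ∘ₚ P      ≈⟨ ∘-congʳ P (X⊗ (X ^ₚ n)) ⟩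
  (false ∷ X ^ₚ n) ∘ₚ P  ≈⟨ false∷-∘ (X ^ₚ n) P ⟩
  P ⊗ ((X ^ₚ n) ∘ₚ P)    ≈⟨ ⊗-congˡ P (X^-∘ n P) ⟩
  P ⊗ P ^ₚ n             ∎
  where open ≈-Reasoning

shift : ℕ → Poly → Poly
shift zero    g = g
shift (suc k) g = false ∷ shift k g

shift-∘ : ∀ k g P → shift k g ∘ₚ P ≈ P ^ₚ k ⊗ (g ∘ₚ P)
shift-∘ zero    g P = ≈-sym (⊗-identityˡ (g ∘ₚ P))
shift-∘ (suc k) g P = begin
  (false ∷ shift k g) ∘ₚ P  ≈⟨ false∷-∘ (shift k g) P ⟩
  P ⊗ (shift k g ∘ₚ P)      ≈⟨ ⊗-congˡ P (shift-∘ k g P) ⟩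
  P ⊗ (P ^ₚ k ⊗ (g ∘ₚ P))   ≈⟨ ⊗-assoc P (P ^ₚ k) (g ∘ₚ P) ⟨
  P ^ₚ suc k ⊗ (g ∘ₚ P)     ∎
  where open ≈-Reasoning

-- Coordinates over ℤ/2[G] and the map U

infix 4 _≈ᵥ_
_≈ᵥ_ : ∀ {n} → Vec Poly n → Vec Poly n → Set
_≈ᵥ_ = Pointwise _≈_

⊕ᵥ-isCommutativeMonoid : ∀ n → IsCommutativeMonoid (_≈ᵥ_ {n}) (zipWith _⊕_) (replicate n [])
⊕ᵥ-isCommutativeMonoid n = record
  { isMonoid = record
    { isSemigroup = record
      { isMagma = record
        { isEquivalence = Pointwise.isEquivalence ≈-isEquivalence n
        ; ∙-cong        = Pointwise.zipWith-cong ⊕-cong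
        }
      ; assoc = Pointwise.zipWith-assoc ⊕-assoc
      }
    ; identity = Pointwise.zipWith-identityˡ (λ _ → ≈-refl) , Pointwise.zipWith-identityʳ ⊕-identityʳ
    }
  ; comm = Pointwise.zipWith-comm ⊕-comm
  }

⊕ᵥ-commutativeMonoid : ℕ → CommutativeMonoid _ _
⊕ᵥ-commutativeMonoid n = record { isCommutativeMonoid = ⊕ᵥ-isCommutativeMonoid n }

module Coords-Monoid = CommutativeMonoid (⊕ᵥ-commutativeMonoid 4)
module ≈ᵥ-Reasoning = SetoidReasoning Coords-Monoid.setoid
open CommutativeSemigroupProperties Coords-Monoid.commutativeSemigroup
  using () renaming (interchange to ⊕v-interchange)

⊕ᵥ-cancelˡ : ∀ {n} (v w : Vec Poly n) → zipWith _⊕_ v (zipWith _⊕_ w v) ≈ᵥ w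
⊕ᵥ-cancelˡ []      []      = []
⊕ᵥ-cancelˡ (p ∷ v) (q ∷ w) = ⊕-cancelˡ p q ∷ ⊕ᵥ-cancelˡ v w

map-false∷-⊕ : ∀ {n} (v w : Vec Poly n) →
  zipWith _⊕_ (Vec.map (false ∷_) v) (Vec.map (false ∷_) w) ≡ Vec.map (false ∷_) (zipWith _⊕_ v w)
map-false∷-⊕ []      []      = refl
map-false∷-⊕ (p ∷ v) (q ∷ w) = cong ((false ∷ p ⊕ q) ∷_) (map-false∷-⊕ v w)

onlyIf : Bool → Coords → Coords
onlyIf a v = if a then v else zeroV

onlyIf-xor : ∀ a b v → onlyIf (a xor b) v ≈ᵥ onlyIf a v ⊕v onlyIf b v
onlyIf-xor false b     v = Coords-Monoid.sym (Coords-Monoid.identityˡ (onlyIf b v))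
onlyIf-xor true  false v = Coords-Monoid.sym (Coords-Monoid.identityʳ v)
onlyIf-xor true  true  v = Coords-Monoid.sym (⊕ᵥ-self v)
  where
  ⊕ᵥ-self : ∀ {n} (v : Vec Poly n) → zipWith _⊕_ v v ≈ᵥ replicate n []
  ⊕ᵥ-self []      = []
  ⊕ᵥ-self (p ∷ v) = ⊕-self p ∷ ⊕ᵥ-self v

onlyIf-shiftG-⊕ : ∀ a u w → onlyIf a (shiftG u ⊕v w) ≈ᵥ shiftG (onlyIf a u) ⊕v onlyIf a w
onlyIf-shiftG-⊕ true  u w = Coords-Monoid.refl
onlyIf-shiftG-⊕ false u w = mk≈ refl ∷ mk≈ refl ∷ mk≈ refl ∷ mk≈ refl ∷ []

coordsFrom-norm : ∀ m p → coordsFrom m p ≈ᵥ coordsFrom m (norm p)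
coordsFrom-norm m []      = Coords-Monoid.refl
coordsFrom-norm m (a ∷ p) =
  Coords-Monoid.trans (Coords-Monoid.∙-congˡ (coordsFrom-norm (suc m) p)) (consN-coordsFrom a (norm p))
  where
  consN-coordsFrom : ∀ a x → coordsFrom m (a ∷ x) ≈ᵥ coordsFrom m (consN a x)
  consN-coordsFrom false []      = Coords-Monoid.refl
  consN-coordsFrom true  []      = Coords-Monoid.refl
  consN-coordsFrom false (b ∷ x) = Coords-Monoid.refl
  consN-coordsFrom true  (b ∷ x) = Coords-Monoid.refl

coordsFrom-cong : ∀ m {p q} → p ≈ q → coordsFrom m p ≈ᵥ coordsFrom m q
coordsFrom-cong m {p} {q} (mk≈ e) = begin
  coordsFrom m p        ≈⟨ coordsFrom-norm m p ⟩
  coordsFrom m (norm p) ≡⟨ cong (coordsFrom m) e ⟩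
  coordsFrom m (norm q) ≈⟨ coordsFrom-norm m q ⟨
  coordsFrom m q        ∎
  where open ≈ᵥ-Reasoning

coordsFrom-⊕ : ∀ m p q → coordsFrom m (p ⊕ q) ≈ᵥ coordsFrom m p ⊕v coordsFrom m q
coordsFrom-⊕ m []      q       = Coords-Monoid.sym (Coords-Monoid.identityˡ (coordsFrom m q))
coordsFrom-⊕ m (a ∷ p) []      = Coords-Monoid.sym (Coords-Monoid.identityʳ _)
coordsFrom-⊕ m (a ∷ p) (b ∷ q) = begin
  onlyIf (a xor b) M ⊕v coordsFrom (suc m) (p ⊕ q)
    ≈⟨ Coords-Monoid.∙-cong (onlyIf-xor a b M) (coordsFrom-⊕ (suc m) p q) ⟩
  (onlyIf a M ⊕v onlyIf b M) ⊕v (coordsFrom (suc m) p ⊕v coordsFrom (suc m) q)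
    ≈⟨ ⊕v-interchange (onlyIf a M) (onlyIf b M) (coordsFrom (suc m) p) (coordsFrom (suc m) q) ⟩
  (onlyIf a M ⊕v coordsFrom (suc m) p) ⊕v (onlyIf b M ⊕v coordsFrom (suc m) q) ∎
  where
  open ≈ᵥ-Reasoning
  M = monoCoords m

windowStep : Vec Coords 4 → Vec Coords 4
windowStep (a ∷ b ∷ c ∷ d ∷ []) = b ∷ c ∷ d ∷ (shiftG a ⊕v d) ∷ []

window-suc : ∀ m → window (suc m) ≡ windowStep (window m)
window-suc m with window m
... | a ∷ b ∷ c ∷ d ∷ [] = refl

monoCoords-rec : ∀ m → monoCoords (4 + m) ≡ shiftG (monoCoords m) ⊕v monoCoords (3 + m)
monoCoords-rec m
  rewrite window-suc (3 + m) | window-suc (2 + m) | window-suc (1 + m) | window-suc m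
  with window m
... | a ∷ b ∷ c ∷ d ∷ [] = refl

-- coordsFrom m p are the coordinates of r^m p, and r^(m+4) = G r^m + r^(m+3).
coordsFrom-rec : ∀ m p → coordsFrom (4 + m) p ≈ᵥ shiftG (coordsFrom m p) ⊕v coordsFrom (3 + m) p
coordsFrom-rec m []      = mk≈ refl ∷ mk≈ refl ∷ mk≈ refl ∷ mk≈ refl ∷ []
coordsFrom-rec m (a ∷ p) rewrite monoCoords-rec m = begin
  onlyIf a (shiftG M ⊕v M₃) ⊕v coordsFrom (5 + m) p
    ≈⟨ Coords-Monoid.∙-cong (onlyIf-shiftG-⊕ a M M₃) (coordsFrom-rec (suc m) p) ⟩
  (shiftG (onlyIf a M) ⊕v onlyIf a M₃) ⊕v (shiftG (coordsFrom (suc m) p) ⊕v coordsFrom (4 + m) p)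
    ≈⟨ ⊕v-interchange (shiftG (onlyIf a M)) (onlyIf a M₃) (shiftG (coordsFrom (suc m) p)) (coordsFrom (4 + m) p) ⟩
  (shiftG (onlyIf a M) ⊕v shiftG (coordsFrom (suc m) p)) ⊕v (onlyIf a M₃ ⊕v coordsFrom (4 + m) p)
    ≡⟨ cong (_⊕v (onlyIf a M₃ ⊕v coordsFrom (4 + m) p)) (map-false∷-⊕ (onlyIf a M) (coordsFrom (suc m) p)) ⟩
  shiftG (onlyIf a M ⊕v coordsFrom (suc m) p) ⊕v (onlyIf a M₃ ⊕v coordsFrom (4 + m) p) ∎
  where
  open ≈ᵥ-Reasoning
  M  = monoCoords m
  M₃ = monoCoords (3 + m)

coordsFrom-shift : ∀ k m p → coordsFrom m (shift k p) ≈ᵥ coordsFrom (k + m) p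
coordsFrom-shift zero    m p = Coords-Monoid.refl
coordsFrom-shift (suc k) m p rewrite sym (+-suc k m) =
  Coords-Monoid.trans (Coords-Monoid.identityˡ _) (coordsFrom-shift k (suc m) p)

coords-G⊗ : ∀ p → coords (G ⊗ p) ≈ᵥ shiftG (coords p)
coords-G⊗ p = begin
  coords (G ⊗ p)                                   ≈⟨ coordsFrom-cong 0 G⊗p ⟩
  coordsFrom 0 (shift 3 (p ⊕ X ⊗ p))               ≈⟨ coordsFrom-shift 3 0 (p ⊕ X ⊗ p) ⟩
  coordsFrom 3 (p ⊕ X ⊗ p)                         ≈⟨ coordsFrom-⊕ 3 p (X ⊗ p) ⟩
  coordsFrom 3 p ⊕v coordsFrom 3 (X ⊗ p)           ≈⟨ Coords-Monoid.∙-congˡ X⊗p-coords ⟩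
  coordsFrom 3 p ⊕v coordsFrom 4 p                 ≈⟨ Coords-Monoid.∙-congˡ (coordsFrom-rec 0 p) ⟩
  coordsFrom 3 p ⊕v (shiftG (coords p) ⊕v coordsFrom 3 p) ≈⟨ ⊕ᵥ-cancelˡ (coordsFrom 3 p) (shiftG (coords p)) ⟩
  shiftG (coords p)                                ∎
  where
  open ≈ᵥ-Reasoning
  G⊗p : G ⊗ p ≈ shift 3 (p ⊕ X ⊗ p)
  G⊗p = ⊗-congʳ p (mk≈ {G} {false ∷ false ∷ false ∷ true ∷ true ∷ []} refl)
  X⊗p-coords : coordsFrom 3 (X ⊗ p) ≈ᵥ coordsFrom 4 p
  X⊗p-coords = Coords-Monoid.trans (coordsFrom-cong 3 (X⊗ p)) (coordsFrom-shift 1 3 p)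

combine : ∀ {n} → Poly → Vec Poly n → Vec Poly n → Poly
combine P gs us = Vec.foldr (λ _ → Poly) _⊕_ [] (zipWith (λ g u → (g ∘ₚ P) ⊗ u) gs us)

combine-cong : ∀ {n} P {gs hs : Vec Poly n} (us : Vec Poly n) → gs ≈ᵥ hs → combine P gs us ≈ combine P hs us
combine-cong P []       []       = ≈-refl
combine-cong P (u ∷ us) (e ∷ es) = ⊕-cong (⊗-congʳ u (∘-congʳ P e)) (combine-cong P us es)

combine-⊕ : ∀ {n} P (gs hs us : Vec Poly n) →
  combine P (zipWith _⊕_ gs hs) us ≈ combine P gs us ⊕ combine P hs us
combine-⊕ P []       []       []       = ≈-refl
combine-⊕ P (g ∷ gs) (h ∷ hs) (u ∷ us) = begin
  ((g ⊕ h) ∘ₚ P) ⊗ u ⊕ combine P (zipWith _⊕_ gs hs) us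
    ≈⟨ ⊕-cong (≈-trans (⊗-congʳ u (∘-distribʳ-⊕ g h P)) (⊗-distribʳ-⊕ (g ∘ₚ P) (h ∘ₚ P) u)) (combine-⊕ P gs hs us) ⟩
  ((g ∘ₚ P) ⊗ u ⊕ (h ∘ₚ P) ⊗ u) ⊕ (combine P gs us ⊕ combine P hs us)
    ≈⟨ ⊕-interchange ((g ∘ₚ P) ⊗ u) ((h ∘ₚ P) ⊗ u) (combine P gs us) (combine P hs us) ⟩
  ((g ∘ₚ P) ⊗ u ⊕ combine P gs us) ⊕ ((h ∘ₚ P) ⊗ u ⊕ combine P hs us) ∎
  where open ≈-Reasoning

combine-shift : ∀ {n} P (gs us : Vec Poly n) →
  combine P (Vec.map (false ∷_) gs) us ≈ P ⊗ combine P gs us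
combine-shift P []       []       = ≈-sym (⊗-zeroʳ P)
combine-shift P (g ∷ gs) (u ∷ us) = begin
  ((false ∷ g) ∘ₚ P) ⊗ u ⊕ combine P (Vec.map (false ∷_) gs) us
    ≈⟨ ⊕-cong (⊗-congʳ u (false∷-∘ g P)) (combine-shift P gs us) ⟩
  (P ⊗ (g ∘ₚ P)) ⊗ u ⊕ P ⊗ combine P gs us
    ≈⟨ ⊕-cong (⊗-assoc P (g ∘ₚ P) u) ≈-refl ⟩
  P ⊗ ((g ∘ₚ P) ⊗ u) ⊕ P ⊗ combine P gs us
    ≈⟨ ⊗-distribˡ-⊕ P _ _ ⟨
  P ⊗ ((g ∘ₚ P) ⊗ u ⊕ combine P gs us) ∎
  where open ≈-Reasoning

U-cong : ∀ {p q} → p ≈ q → U p ≈ U q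
U-cong e = combine-cong F Ubasis (coordsFrom-cong 0 e)

U-⊕ : ∀ p q → U (p ⊕ q) ≈ U p ⊕ U q
U-⊕ p q = ≈-trans (combine-cong F Ubasis (coordsFrom-⊕ 0 p q)) (combine-⊕ F (coords p) (coords q) Ubasis)

U-G⊗ : ∀ p → U (G ⊗ p) ≈ F ⊗ U p
U-G⊗ p = ≈-trans (combine-cong F Ubasis (coords-G⊗ p)) (combine-shift F (coords p) Ubasis)

U-G^⊗ : ∀ k p → U (G ^ₚ k ⊗ p) ≈ F ^ₚ k ⊗ U p
U-G^⊗ zero    p = ≈-trans (U-cong (⊗-identityˡ p)) (≈-sym (⊗-identityˡ (U p)))
U-G^⊗ (suc k) p = begin
  U ((G ⊗ G ^ₚ k) ⊗ p)  ≈⟨ U-cong (⊗-assoc G (G ^ₚ k) p) ⟩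
  U (G ⊗ (G ^ₚ k ⊗ p))  ≈⟨ U-G⊗ (G ^ₚ k ⊗ p) ⟩
  F ⊗ U (G ^ₚ k ⊗ p)    ≈⟨ ⊗-congˡ F (U-G^⊗ k p) ⟩
  F ⊗ (F ^ₚ k ⊗ U p)    ≈⟨ ⊗-assoc F (F ^ₚ k) (U p) ⟨
  (F ⊗ F ^ₚ k) ⊗ U p    ∎
  where open ≈-Reasoning

-- The recurrence for T(Fⁿ)

F⁴≈G⁴⊕G⊗F : F ^ₚ 4 ≈ G ^ₚ 4 ⊕ G ⊗ F
F⁴≈G⁴⊕G⊗F = mk≈ refl

G⁴≈F⁴⊕F⊗G : G ^ₚ 4 ≈ F ^ₚ 4 ⊕ F ⊗ G
G⁴≈F⁴⊕F⊗G = mk≈ refl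

^-4+ : ∀ P Q → P ^ₚ 4 ≈ Q ^ₚ 4 ⊕ Q ⊗ P →
       ∀ n → P ^ₚ (4 + n) ≈ Q ^ₚ 4 ⊗ P ^ₚ n ⊕ Q ⊗ P ^ₚ (1 + n)
^-4+ P Q P⁴≈ n = begin
  P ^ₚ (4 + n)                        ≈⟨ ^-+ P 4 n ⟩
  P ^ₚ 4 ⊗ P ^ₚ n                     ≈⟨ ⊗-congʳ (P ^ₚ n) P⁴≈ ⟩
  (Q ^ₚ 4 ⊕ Q ⊗ P) ⊗ P ^ₚ n           ≈⟨ ⊗-distribʳ-⊕ (Q ^ₚ 4) (Q ⊗ P) (P ^ₚ n) ⟩
  Q ^ₚ 4 ⊗ P ^ₚ n ⊕ (Q ⊗ P) ⊗ P ^ₚ n  ≈⟨ ⊕-cong ≈-refl (⊗-assoc Q P (P ^ₚ n)) ⟩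
  Q ^ₚ 4 ⊗ P ^ₚ n ⊕ Q ⊗ P ^ₚ (1 + n)  ∎
  where open ≈-Reasoning

T-cong : ∀ {h h′} → h ≈ h′ → T h ≈ T h′
T-cong e = ⊕-cong (U-cong (∘-congʳ F e)) (∘-congʳ G e)

T-⊕ : ∀ g h → T (g ⊕ h) ≈ T g ⊕ T h
T-⊕ g h = begin
  U ((g ⊕ h) ∘ₚ F) ⊕ (g ⊕ h) ∘ₚ G
    ≈⟨ ⊕-cong (≈-trans (U-cong (∘-distribʳ-⊕ g h F)) (U-⊕ (g ∘ₚ F) (h ∘ₚ F))) (∘-distribʳ-⊕ g h G) ⟩
  (U (g ∘ₚ F) ⊕ U (h ∘ₚ F)) ⊕ (g ∘ₚ G ⊕ h ∘ₚ G)
    ≈⟨ ⊕-interchange (U (g ∘ₚ F)) (U (h ∘ₚ F)) (g ∘ₚ G) (h ∘ₚ G) ⟩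
  (U (g ∘ₚ F) ⊕ g ∘ₚ G) ⊕ (U (h ∘ₚ F) ⊕ h ∘ₚ G) ∎
  where open ≈-Reasoning

T-X^ : ∀ n → T (X ^ₚ n) ≈ U (F ^ₚ n) ⊕ G ^ₚ n
T-X^ n = ⊕-cong (U-cong (X^-∘ n F)) (X^-∘ n G)

T-X^-rec : ∀ n → T (X ^ₚ (4 + n)) ≈ F ^ₚ 4 ⊗ T (X ^ₚ n) ⊕ F ⊗ T (X ^ₚ (1 + n))
T-X^-rec n = begin
  T (X ^ₚ (4 + n))
    ≈⟨ T-X^ (4 + n) ⟩
  U (F ^ₚ (4 + n)) ⊕ G ^ₚ (4 + n)
    ≈⟨ ⊕-cong (U-cong (^-4+ F G F⁴≈G⁴⊕G⊗F n)) (^-4+ G F G⁴≈F⁴⊕F⊗G n) ⟩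
  U (G ^ₚ 4 ⊗ Fⁿ ⊕ G ⊗ F¹⁺ⁿ) ⊕ (F ^ₚ 4 ⊗ Gⁿ ⊕ F ⊗ G¹⁺ⁿ)
    ≈⟨ ⊕-cong (≈-trans (U-⊕ (G ^ₚ 4 ⊗ Fⁿ) (G ⊗ F¹⁺ⁿ)) (⊕-cong (U-G^⊗ 4 Fⁿ) (U-G⊗ F¹⁺ⁿ))) ≈-refl ⟩
  (F ^ₚ 4 ⊗ U Fⁿ ⊕ F ⊗ U F¹⁺ⁿ) ⊕ (F ^ₚ 4 ⊗ Gⁿ ⊕ F ⊗ G¹⁺ⁿ)
    ≈⟨ ⊕-interchange (F ^ₚ 4 ⊗ U Fⁿ) (F ⊗ U F¹⁺ⁿ) (F ^ₚ 4 ⊗ Gⁿ) (F ⊗ G¹⁺ⁿ) ⟩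
  (F ^ₚ 4 ⊗ U Fⁿ ⊕ F ^ₚ 4 ⊗ Gⁿ) ⊕ (F ⊗ U F¹⁺ⁿ ⊕ F ⊗ G¹⁺ⁿ)
    ≈⟨ ⊕-cong (⊗-distribˡ-⊕ (F ^ₚ 4) (U Fⁿ) Gⁿ) (⊗-distribˡ-⊕ F (U F¹⁺ⁿ) G¹⁺ⁿ) ⟨
  F ^ₚ 4 ⊗ (U Fⁿ ⊕ Gⁿ) ⊕ F ⊗ (U F¹⁺ⁿ ⊕ G¹⁺ⁿ)
    ≈⟨ ⊕-cong (⊗-congˡ (F ^ₚ 4) (T-X^ n)) (⊗-congˡ F (T-X^ (1 + n))) ⟨
  F ^ₚ 4 ⊗ T (X ^ₚ n) ⊕ F ⊗ T (X ^ₚ (1 + n)) ∎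
  where
  open ≈-Reasoning
  Fⁿ = F ^ₚ n
  F¹⁺ⁿ = F ^ₚ (1 + n)
  Gⁿ = G ^ₚ n
  G¹⁺ⁿ = G ^ₚ (1 + n)

t : ℕ → Poly
t 0 = []
t 1 = []
t 2 = []
t 3 = X
t (suc (suc (suc (suc n)))) = shift 4 (t n) ⊕ shift 1 (t (suc n))

T-X^≈t∘F : ∀ n → T (X ^ₚ n) ≈ t n ∘ₚ F
T-X^≈t∘F 0 = mk≈ refl
T-X^≈t∘F 1 = mk≈ refl
T-X^≈t∘F 2 = mk≈ refl
T-X^≈t∘F 3 = mk≈ refl
T-X^≈t∘F (suc (suc (suc (suc n)))) = begin
  T (X ^ₚ (4 + n))
    ≈⟨ T-X^-rec n ⟩
  F ^ₚ 4 ⊗ T (X ^ₚ n) ⊕ F ⊗ T (X ^ₚ (1 + n))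
    ≈⟨ ⊕-cong (⊗-congˡ (F ^ₚ 4) (T-X^≈t∘F n)) (⊗-congˡ F (T-X^≈t∘F (suc n))) ⟩
  F ^ₚ 4 ⊗ (t n ∘ₚ F) ⊕ F ⊗ (t (1 + n) ∘ₚ F)
    ≈⟨ ⊕-cong (shift-∘ 4 (t n) F) (false∷-∘ (t (1 + n)) F) ⟨
  shift 4 (t n) ∘ₚ F ⊕ shift 1 (t (1 + n)) ∘ₚ F
    ≈⟨ ∘-distribʳ-⊕ (shift 4 (t n)) (shift 1 (t (1 + n))) F ⟨
  t (4 + n) ∘ₚ F ∎
  where open ≈-Reasoning

shift-support : ∀ d g k → coeff (shift d g) k ≡ true → ∃ λ i → k ≡ d + i × coeff g i ≡ true
shift-support zero    g k       e = k , refl , e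
shift-support (suc d) g (suc k) e with shift-support d g k e
... | i , refl , e′ = i , refl , e′

xor≡true : ∀ a b → a xor b ≡ true → a ≡ true ⊎ b ≡ true
xor≡true true  b e = inj₁ refl
xor≡true false b e = inj₂ e

Admissible : ℕ → ℕ → Set
Admissible n k = k + 2 ≤ n × k % 2 ≡ n % 2

+-%2-congˡ : ∀ m {k n} → k % 2 ≡ n % 2 → (m + k) % 2 ≡ (m + n) % 2
+-%2-congˡ m {k} {n} e = begin
  (m + k) % 2             ≡⟨ %-distribˡ-+ m k 2 ⟩
  (m % 2 + k % 2) % 2     ≡⟨ cong (λ x → (m % 2 + x) % 2) e ⟩
  (m % 2 + n % 2) % 2     ≡⟨ %-distribˡ-+ m n 2 ⟨
  (m + n) % 2             ∎
  where open ≡-Reasoning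

2+-%2 : ∀ m → (2 + m) % 2 ≡ m % 2
2+-%2 m = trans (cong (_% 2) (+-comm 2 m)) ([m+n]%n≡m%n m 2)

admissible-4+ : ∀ {n k} → Admissible n k → Admissible (4 + n) (4 + k)
admissible-4+ {n} {k} (k+2≤n , k≡n) = +-monoʳ-≤ 4 k+2≤n , +-%2-congˡ 4 {k} {n} k≡n

admissible-1+ : ∀ {n k} → Admissible (1 + n) k → Admissible (4 + n) (1 + k)
admissible-1+ {n} {k} (k+2≤1+n , k≡1+n) =
  m≤n⇒m≤1+n (m≤n⇒m≤1+n (s≤s k+2≤1+n)) ,
  trans (+-%2-congˡ 1 {k} {1 + n} k≡1+n) (trans (2+-%2 n) (sym (trans (2+-%2 (2 + n)) (2+-%2 n))))

t-support : ∀ n k → coeff (t n) k ≡ true → Admissible n k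
t-support 3 1 _ = s≤s (s≤s (s≤s z≤n)) , refl
t-support 3 (suc (suc k)) ()
t-support (suc (suc (suc (suc n)))) k e
  with xor≡true _ _ (trans (sym (coeff-⊕ (shift 4 (t n)) (shift 1 (t (suc n))) k)) e)
... | inj₁ e₄ with shift-support 4 (t n) k e₄
...   | i , refl , eᵢ = admissible-4+ (t-support n i eᵢ)
t-support (suc (suc (suc (suc n)))) k e
    | inj₂ e₁ with shift-support 1 (t (suc n)) k e₁
...   | i , refl , eᵢ = admissible-1+ (t-support (suc n) i eᵢ)

shift-∷ : ∀ m a h → shift m (a ∷ h) ≈ shift m (a ∷ []) ⊕ shift (suc m) h
shift-∷ zero    a h = mk≈ (cong (λ b → norm (b ∷ h)) (sym (xor-identityʳ a)))
shift-∷ (suc m) a h = ∷-cong false (shift-∷ m a h)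

shift-≈[] : ∀ m {p} → p ≈ [] → shift m p ≈ []
shift-≈[] zero    e = e
shift-≈[] (suc m) e = ≈-trans (∷-cong false (shift-≈[] m e)) (mk≈ refl)

shift-oneₚ : ∀ m → shift m oneₚ ≈ X ^ₚ m
shift-oneₚ zero    = ≈-refl
shift-oneₚ (suc m) = ≈-trans (∷-cong false (shift-oneₚ m)) (≈-sym (X⊗ (X ^ₚ m)))

tFrom : ℕ → Poly → Poly
tFrom m []      = []
tFrom m (a ∷ h) = scale a (t m) ⊕ tFrom (suc m) h

T-shift : ∀ m h → T (shift m h) ≈ tFrom m h ∘ₚ F
T-shift m []      = ≈-trans (T-cong (shift-≈[] m ≈-refl)) (mk≈ refl)
T-shift m (a ∷ h) = begin
  T (shift m (a ∷ h))                         ≈⟨ T-cong (shift-∷ m a h) ⟩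
  T (shift m (a ∷ []) ⊕ shift (suc m) h)      ≈⟨ T-⊕ (shift m (a ∷ [])) (shift (suc m) h) ⟩
  T (shift m (a ∷ [])) ⊕ T (shift (suc m) h)  ≈⟨ ⊕-cong (T-shift-singleton a) (T-shift (suc m) h) ⟩
  scale a (t m) ∘ₚ F ⊕ tFrom (suc m) h ∘ₚ F   ≈⟨ ∘-distribʳ-⊕ (scale a (t m)) (tFrom (suc m) h) F ⟨
  tFrom m (a ∷ h) ∘ₚ F                        ∎
  where
  open ≈-Reasoning
  T-shift-singleton : ∀ a → T (shift m (a ∷ [])) ≈ scale a (t m) ∘ₚ F
  T-shift-singleton false = ≈-trans (T-cong (shift-≈[] m (mk≈ refl))) (mk≈ refl)
  T-shift-singleton true  = ≈-trans (T-cong (shift-oneₚ m)) (T-X^≈t∘F m)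

theorem2p4 : (T oneₚ ≈ₚ zeroₚ × T X ≈ₚ zeroₚ × T (X ^ₚ 2) ≈ₚ zeroₚ × T (X ^ₚ 3) ≈ₚ F)
    × ((h : Poly) → Σ Poly (λ h′ → T h ≈ₚ h′ ∘ₚ F))
    × ((n : ℕ) → Σ Poly (λ c →
         T (X ^ₚ n) ≈ₚ c ∘ₚ F
         × ((k : ℕ) → coeff c k ≡ true → (k + 2 ≤ n × k % 2 ≡ n % 2))))
theorem2p4 =
  (refl , refl , refl , refl) ,
  (λ h → tFrom 0 h , norm≡ (T-shift 0 h)) ,
  (λ n → t n , norm≡ (T-X^≈t∘F n) , t-support n)
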